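{- Let $P$ be an $n\times n$ Strang canonical permutation matrix all of whose nontrivial sections have trace $0$. Set $P_0=P$ and, for $k\ge1$, $P_k=R_kP_{k-1}$, where $R_k$ is the reducing matrix of $P_{k-1}$. Then there is an $m\ge 0$ with $P_m=I$, and $P=R_1R_2\cdots R_m$.
   Context: For an $n\times n$ permutation matrix $Q$, let $c_i(Q)$ be the column index of the $1$ in row $i$. Rows $i<j$ form an inverted pair if $c_i(Q)>c_j(Q)$, otherwise a contented pair. Row $i$ is positive if $c_i(Q)>i$, negative if $c_i(Q)<i$, neutral if $c_i(Q)=i$. Sections: take the finest partition of $\{1,\dots,n\}$ into consecutive intervals each mapped onto itself by $i\mapsto c_i(Q)$; the corresponding diagonal blocks of $Q$ (so $Q$ is block diagonal with these blocks) are the sections of $Q$; a $1\times1$ section is trivial. A section is upper-canonical if its positive rows are pairwise contented, lower-canonical if its negative rows are pairwise contented; $Q$ is Strang canonical if every section is both upper- and lower-canonical. A reducing swap of $Q$ is the elementary matrix interchanging adjacent rows $i,i+1$ of $Q$ where row $i$ is positive and row $i+1$ is negative; the reducing matrix of $Q$ is the product of all reducing swaps of $Q$ (these act on disjoint pairs of rows; the empty product is $I$). -}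

module Defs where

open import Data.Nat using (ℕ; zero; suc; _+_; _*_; _<_; _≤_; _<ᵇ_; _≤ᵇ_; _≡ᵇ_)
open import Data.Nat.Properties using (_≟_)
open import Data.Fin using (Fin; toℕ)
open import Data.Fin.Properties using (any?)
open import Data.Bool using (Bool; true; false; if_then_else_; _∧_; _∨_; not)
open import Data.List using (List; []; _∷_; foldr; filter; tabulate)
open import Data.Nat.ListAction using (sum)
open import Data.Product using (Σ; _×_; _,_; ∃)
open import Relation.Nullary using (¬_; yes; no)
open import Relation.Nullary.Decidable using (⌊_⌋)
open import Relation.Binary.PropositionalEquality using (_≡_; _≢_)

-- Indices are 0-based: rows/columns are Fin n.
-- An n×n matrix with natural-number entries.
Mat : ℕ → Set
Mat n = Fin n → Fin n → ℕ

_≈_ : ∀ {n} → Mat n → Mat n → Set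
A ≈ B = ∀ i j → A i j ≡ B i j

IsPermMatrix : ∀ {n} → Mat n → Set
IsPermMatrix {n} P =
  (∀ i j → (P i j ≡ 0) Data.Sum.⊎ (P i j ≡ 1)) ×
  (∀ i → Σ (Fin n) λ j → P i j ≡ 1 × (∀ j' → P i j' ≡ 1 → j' ≡ j)) ×
  (∀ j → Σ (Fin n) λ i → P i j ≡ 1 × (∀ i' → P i' j ≡ 1 → i' ≡ i))
  where import Data.Sum

I : ∀ {n} → Mat n
I i j = if toℕ i ≡ᵇ toℕ j then 1 else 0

_⊗_ : ∀ {n} → Mat n → Mat n → Mat n
_⊗_ {n} A B i j = sum (tabulate {n = n} λ k → A i k * B k j)

infixl 7 _⊗_

-- c_i(Q): column index of the 1 in row i (the first one found; for a
-- permutation matrix it is the unique one).  The fallback `i` is never used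
-- for permutation matrices.
col : ∀ {n} → Mat n → Fin n → Fin n
col Q i with any? (λ j → Q i j ≟ 1)
... | yes (j , _) = j
... | no _ = i

Positive : ∀ {n} → Mat n → Fin n → Set
Positive Q i = toℕ i < toℕ (col Q i)

Negative : ∀ {n} → Mat n → Fin n → Set
Negative Q i = toℕ (col Q i) < toℕ i

positive? : ∀ {n} → Mat n → Fin n → Bool
positive? Q i = toℕ i <ᵇ toℕ (col Q i)

negative? : ∀ {n} → Mat n → Fin n → Bool
negative? Q i = toℕ (col Q i) <ᵇ toℕ i

Contented : ∀ {n} → Mat n → Fin n → Fin n → Set
Contented Q i j = toℕ (col Q i) < toℕ (col Q j)

-- A cut at k (0 ≤ k ≤ n) means the initial segment {0,…,k-1} is
-- mapped into (hence onto) itself by i ↦ c_i(Q).  The finest partition into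
-- consecutive invariant intervals is given by all cuts; a section is an
-- interval [a,b) with a < b, cuts at a and b, and no cut strictly between.
Cut : ∀ {n} → Mat n → ℕ → Set
Cut {n} Q k = k ≤ n × (∀ (i : Fin n) → toℕ i < k → toℕ (col Q i) < k)

Section : ∀ {n} → Mat n → ℕ → ℕ → Set
Section Q a b = a < b × Cut Q a × Cut Q b × (∀ k → a < k → k < b → ¬ Cut Q k)

InInterval : ∀ {n} → ℕ → ℕ → Fin n → Set
InInterval a b i = a ≤ toℕ i × toℕ i < b

inInterval? : ∀ {n} → ℕ → ℕ → Fin n → Bool
inInterval? a b i = (a ≤ᵇ toℕ i) ∧ (toℕ i <ᵇ b)

sectionTrace : ∀ {n} → Mat n → ℕ → ℕ → ℕ
sectionTrace {n} Q a b =
  sum (tabulate {n = n} λ i → if inInterval? a b i then Q i i else 0)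

UpperCanonical : ∀ {n} → Mat n → ℕ → ℕ → Set
UpperCanonical Q a b = ∀ i j → InInterval a b i → InInterval a b j →
  toℕ i < toℕ j → Positive Q i → Positive Q j → Contented Q i j

LowerCanonical : ∀ {n} → Mat n → ℕ → ℕ → Set
LowerCanonical Q a b = ∀ i j → InInterval a b i → InInterval a b j →
  toℕ i < toℕ j → Negative Q i → Negative Q j → Contented Q i j

StrangCanonical : ∀ {n} → Mat n → Set
StrangCanonical Q = ∀ a b → Section Q a b → UpperCanonical Q a b × LowerCanonical Q a b

-- a section [a,b) is nontrivial iff b - a ≥ 2, i.e. suc a < b
NontrivialSectionsTraceZero : ∀ {n} → Mat n → Set
NontrivialSectionsTraceZero Q = ∀ a b → Section Q a b → suc a < b → sectionTrace Q a b ≡ 0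

-- elementary matrix interchanging rows k and k+1 (of I)
swapMat : ∀ {n} → ℕ → Mat n
swapMat k i j =
  if (toℕ i ≡ᵇ k) ∧ (toℕ j ≡ᵇ suc k) then 1
  else if (toℕ i ≡ᵇ suc k) ∧ (toℕ j ≡ᵇ k) then 1
  else if (toℕ i ≡ᵇ toℕ j) ∧ not (toℕ i ≡ᵇ k) ∧ not (toℕ i ≡ᵇ suc k) then 1
  else 0

reducingStart? : ∀ {n} → Mat n → Fin n → Bool
reducingStart? {n} Q i =
  positive? Q i ∧
  ⌊ any? (λ (j : Fin n) → Data.Bool._≟_ ((toℕ j ≡ᵇ suc (toℕ i)) ∧ negative? Q j) true) ⌋
  where import Data.Bool

reducingMatrix : ∀ {n} → Mat n → Mat n
reducingMatrix {n} Q =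
  foldr (λ i M → swapMat (toℕ i) ⊗ M) I
        (filter (λ i → Data.Bool._≟_ (reducingStart? Q i) true) (Data.List.allFin n))
  where import Data.Bool
        import Data.List

Pseq : ∀ {n} → Mat n → ℕ → Mat n
Pseq P zero = P
Pseq P (suc k) = reducingMatrix (Pseq P k) ⊗ Pseq P k

-- R P k = R_{k+1} = reducing matrix of P_k
R : ∀ {n} → Mat n → ℕ → Mat n
R P k = reducingMatrix (Pseq P k)

-- prodR P m = R_1 R_2 ⋯ R_m  (I for m = 0)
prodR : ∀ {n} → Mat n → ℕ → Mat n
prodR P zero = I
prodR P (suc m) = prodR P m ⊗ R P m

-- A permutation matrix is determined by its column map c.  Strang canonicity and
-- the trace condition force c to avoid the pattern 321: the middle row of such a
-- pattern is positive, negative or fixed, and it then shares a section with a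
-- positive earlier row, shares a section with a negative later row, or is a 1 on the
-- diagonal of a nontrivial section.  A 321-avoiding permutation other than the
-- identity has a positive row immediately followed by a negative one, so its reducing
-- matrix is a nonempty product of disjoint adjacent swaps.  Applying it keeps c
-- 321-avoiding and lowers the excess Σᵢ (cᵢ ∸ i) by the number of swaps, so the
-- sequence P_k reaches I; since every reducing matrix is an involution,
-- P = R₁ R₂ ⋯ Rₘ.

module Submission where

open import Defs
open import Data.Nat using (ℕ; zero; suc; _+_; _*_; _∸_; _<_; _≤_; _≡ᵇ_; z≤n; s≤s; s≤s⁻¹; s<s; s<s⁻¹; _<?_; _≤?_)
open import Data.Nat.Properties
open import Data.Nat.ListAction using (sum)
open import Data.Nat.Induction using (<-wellFounded)
open import Data.Nat.Tactic.RingSolver using (solve-∀)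
open import Data.Fin using (Fin; toℕ; fromℕ<) renaming (zero to fzero; suc to fsuc)
open import Data.Fin.Properties using (toℕ-injective; toℕ<n; toℕ-fromℕ<; fromℕ<-toℕ; any?; all?; ¬∀⟶∃¬; pigeonhole) renaming (_≟_ to _≟ᶠ_)
open import Data.Bool using (true; false; if_then_else_; _∧_; T)
open import Data.Bool.Properties using (T-≡; T-∧; ∧-identityʳ; ∧-zeroʳ)
open import Data.List using (List; []; _∷_; foldr; filter; tabulate; allFin)
open import Data.List.Membership.Propositional using (_∈_; _∉_)
open import Data.List.Membership.Propositional.Properties using (∈-filter⁺; ∈-filter⁻; ∈-allFin)
open import Data.List.Relation.Unary.All as All using (All; []; _∷_)
open import Data.List.Relation.Unary.All.Properties using (all-filter)
open import Data.List.Relation.Unary.Any using (here; there)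
open import Data.List.Relation.Unary.AllPairs using (_∷_)
open import Data.List.Relation.Unary.Unique.Propositional using (Unique)
open import Data.List.Relation.Unary.Unique.Propositional.Properties using (filter⁺; allFin⁺)
open import Data.Product using (Σ; ∃; ∃₂; _×_; _,_; proj₁; proj₂)
open import Data.Sum using (_⊎_; inj₁; inj₂)
open import Data.Empty using (⊥; ⊥-elim)
open import Function using (id; _∘_; Equivalence)
open import Induction.WellFounded using (Acc; acc)
open import Relation.Binary.Definitions using (tri<; tri≈; tri>)
open import Relation.Binary.PropositionalEquality using (_≡_; _≢_; refl; sym; trans; cong; subst; subst₂; module ≡-Reasoning)
open import Relation.Nullary using (¬_; Dec; yes; no; does; contradiction)
open import Relation.Nullary.Decidable using (dec-true; dec-false; toWitness; fromWitness; _×-dec_; _→-dec_)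
open import Relation.Unary using (Pred; Decidable)
import Data.Bool as Bool

module _ {p} {P : Pred ℕ p} (P? : Decidable P) where

  noneBelow-or-least : ∀ m → (∀ {i} → i < m → ¬ P i) ⊎ ∃ λ j → j < m × P j × (∀ {i} → i < j → ¬ P i)
  noneBelow-or-least zero = inj₁ λ ()
  noneBelow-or-least (suc m) with noneBelow-or-least m
  ... | inj₂ (j , j<m , Pj , least) = inj₂ (j , m<n⇒m<1+n j<m , Pj , least)
  ... | inj₁ none with P? m
  ...   | yes Pm = inj₂ (m , n<1+n m , Pm , none)
  ...   | no ¬Pm = inj₁ noneUpTo
    where
    noneUpTo : ∀ {i} → i < suc m → ¬ P i
    noneUpTo i<1+m with m<1+n⇒m<n∨m≡n i<1+m
    ... | inj₁ i<m  = none i<m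
    ... | inj₂ refl = ¬Pm

  greatest-below : P 0 → ∀ x → ∃ λ a → a ≤ x × P a × (∀ {k} → a < k → k ≤ x → ¬ P k)
  greatest-below P0 zero = 0 , z≤n , P0 , λ 0<k k≤0 _ → <-irrefl refl (<-≤-trans 0<k k≤0)
  greatest-below P0 (suc x) with P? (suc x)
  ... | yes Px+1 = suc x , ≤-refl , Px+1 , λ x+1<k k≤x+1 _ → <-irrefl refl (<-≤-trans x+1<k k≤x+1)
  ... | no ¬Px+1 with greatest-below P0 x
  ...   | a , a≤x , Pa , noneBetween = a , m≤n⇒m≤1+n a≤x , Pa , noneUpTo
    where
    noneUpTo : ∀ {k} → a < k → k ≤ suc x → ¬ P k
    noneUpTo a<k k≤x+1 with m≤n⇒m<n∨m≡n k≤x+1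
    ... | inj₁ k<x+1 = noneBetween a<k (s≤s⁻¹ k<x+1)
    ... | inj₂ refl  = ¬Px+1

-- Exchanges s and s + 1 for every s ∈ S; meant for S without two consecutive elements.
module PairSwap {p} {S : Pred ℕ p} (S? : Decidable S) where

  pairSwap : ℕ → ℕ
  pairSwap r with S? r
  pairSwap r       | yes _ = suc r
  pairSwap zero    | no  _ = zero
  pairSwap (suc s) | no  _ with S? s
  ... | yes _ = s
  ... | no  _ = suc s

  pairSwap-first : ∀ {s} → S s → pairSwap s ≡ suc s
  pairSwap-first {s} Ss with S? s
  ... | yes _   = refl
  ... | no ¬Ss  = contradiction Ss ¬Ss

  pairSwap-second : ∀ {s} → ¬ S (suc s) → S s → pairSwap (suc s) ≡ s
  pairSwap-second {s} ¬Ss+1 Ss with S? (suc s)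
  ... | yes Ss+1 = contradiction Ss+1 ¬Ss+1
  ... | no _ with S? s
  ...   | yes _   = refl
  ...   | no ¬Ss  = contradiction Ss ¬Ss

  pairSwap-fixed : ∀ {r} → ¬ S r → (∀ {s} → r ≡ suc s → ¬ S s) → pairSwap r ≡ r
  pairSwap-fixed {r} ¬Sr _ with S? r
  ... | yes Sr = contradiction Sr ¬Sr
  pairSwap-fixed {zero}  _ _      | no _ = refl
  pairSwap-fixed {suc s} _ ¬Spred | no _ with S? s
  ... | yes Ss = contradiction Ss (¬Spred refl)
  ... | no _   = refl

  data PairSwapView (r : ℕ) : Set p where
    first  : S r → pairSwap r ≡ suc r → PairSwapView r
    second : ∀ {s} → r ≡ suc s → S s → pairSwap r ≡ s → PairSwapView r
    fixed  : ¬ S r → (∀ {s} → r ≡ suc s → ¬ S s) → pairSwap r ≡ r → PairSwapView r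

  pairSwapView : ∀ r → PairSwapView r
  pairSwapView r with S? r
  ... | yes Sr = first Sr (pairSwap-first Sr)
  pairSwapView zero    | no ¬S0 = fixed ¬S0 (λ ()) (pairSwap-fixed ¬S0 (λ ()))
  pairSwapView (suc s) | no ¬Sr with S? s
  ... | yes Ss = second refl Ss (pairSwap-second ¬Sr Ss)
  ... | no ¬Ss = fixed ¬Sr ¬Spred (pairSwap-fixed ¬Sr ¬Spred)
    where
    ¬Spred : ∀ {s'} → suc s ≡ suc s' → ¬ S s'
    ¬Spred refl = ¬Ss

  module _ (noConsecutive : ∀ {s} → S s → ¬ S (suc s)) where

    pairSwap-involutive : ∀ r → pairSwap (pairSwap r) ≡ r
    pairSwap-involutive r with pairSwapView r
    ... | fixed _ _ eq rewrite eq = eq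
    ... | first Sr eq rewrite eq = pairSwap-second (noConsecutive Sr) Sr
    ... | second refl Ss eq rewrite eq = pairSwap-first Ss

    pairSwap-< : ∀ {n} → (∀ {s} → S s → suc s < n) → ∀ {r} → r < n → pairSwap r < n
    pairSwap-< bound {r} r<n with pairSwapView r
    ... | first Sr eq        rewrite eq = bound Sr
    ... | second refl _ eq   rewrite eq = <-trans (n<1+n _) r<n
    ... | fixed _ _ eq       rewrite eq = r<n

    pairSwap-monotone : ∀ {i j} → i < j → ¬ (S i × j ≡ suc i) → pairSwap i < pairSwap j
    pairSwap-monotone {i} {j} i<j notPair with pairSwapView i
    ... | first Si eqi rewrite eqi = afterFirst (pairSwapView j)
      where
      afterFirst : PairSwapView j → suc i < pairSwap j
      afterFirst (first _ eqj) rewrite eqj = s<s i<j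
      afterFirst (second {s} refl Ss eqj) rewrite eqj with <-cmp (suc i) s
      ... | tri< i+1<s _ _ = i+1<s
      ... | tri≈ _ refl _  = contradiction Ss (noConsecutive Si)
      ... | tri> _ _ s<i+1 = contradiction (Si , cong suc (≤-antisym (s≤s⁻¹ s<i+1) (s≤s⁻¹ i<j))) notPair
      afterFirst (fixed _ _ eqj) rewrite eqj with m≤n⇒m<n∨m≡n i<j
      ... | inj₁ i+1<j = i+1<j
      ... | inj₂ i+1≡j = contradiction (Si , sym i+1≡j) notPair
    ... | second {s} refl _ eqi rewrite eqi = afterSecond (pairSwapView j)
      where
      afterSecond : PairSwapView j → s < pairSwap j
      afterSecond (first _ eqj)           rewrite eqj = <-trans (n<1+n s) (<-trans i<j (n<1+n j))
      afterSecond (second refl _ eqj)     rewrite eqj = s<s⁻¹ i<j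
      afterSecond (fixed _ _ eqj)         rewrite eqj = <-trans (n<1+n s) i<j
    ... | fixed ¬Si _ eqi rewrite eqi = afterFixed (pairSwapView j)
      where
      afterFixed : PairSwapView j → i < pairSwap j
      afterFixed (first _ eqj) rewrite eqj = <-trans i<j (n<1+n j)
      afterFixed (second {t} refl St eqj) rewrite eqj with m≤n⇒m<n∨m≡n (s≤s⁻¹ i<j)
      ... | inj₁ i<t = i<t
      ... | inj₂ refl = contradiction St ¬Si
      afterFixed (fixed _ _ eqj) rewrite eqj = i<j

-- Pattern avoidance and reducing swaps for maps ℕ → ℕ

InjectiveOn : ℕ → (ℕ → ℕ) → Set
InjectiveOn n p = ∀ {i j} → i < n → j < n → p i ≡ p j → i ≡ j

Avoids321 : ℕ → (ℕ → ℕ) → Set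
Avoids321 n p = ∀ {i j k} → i < j → j < k → k < n → p k < p j → p j < p i → ⊥

expansive-injection⇒id : ∀ {m p} → InjectiveOn m p → (∀ {i} → i < m → i ≤ p i × p i < m) →
  ∀ {i} → i < m → p i ≡ i
expansive-injection⇒id {suc m} {p} inj bounds = pointwise
  where
  top : p m ≡ m
  top = ≤-antisym (s≤s⁻¹ (proj₂ (bounds (n<1+n m)))) (proj₁ (bounds (n<1+n m)))
  injBelow : InjectiveOn m p
  injBelow i<m j<m = inj (m<n⇒m<1+n i<m) (m<n⇒m<1+n j<m)
  boundsBelow : ∀ {k} → k < m → k ≤ p k × p k < m
  boundsBelow {k} k<m with bounds (m<n⇒m<1+n k<m)
  ... | k≤pk , pk<1+m with m<1+n⇒m<n∨m≡n pk<1+m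
  ...   | inj₁ pk<m = k≤pk , pk<m
  ...   | inj₂ pk≡m = contradiction (inj (m<n⇒m<1+n k<m) (n<1+n m) (trans pk≡m (sym top))) (<⇒≢ k<m)
  pointwise : ∀ {i} → i < suc m → p i ≡ i
  pointwise i<1+m with m<1+n⇒m<n∨m≡n i<1+m
  ... | inj₁ i<m  = expansive-injection⇒id injBelow boundsBelow i<m
  ... | inj₂ refl = top

module _ {n} {p : ℕ → ℕ} (inj : InjectiveOn n p) where

  -- If p r < t, the rows [0, t) and r would be t + 1 rows mapped injectively into [0, t).
  prefix-closed⇒suffix-closed : ∀ {t} → t ≤ n → (∀ {i} → i < t → p i < t) → ∀ {r} → r < n → t ≤ r → t ≤ p r
  prefix-closed⇒suffix-closed {t} t≤n prefixClosed {r} r<n t≤r with p r <? t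
  ... | no  pr≮t = ≮⇒≥ pr≮t
  ... | yes pr<t = ⊥-elim collision
    where
    h : ℕ → ℕ
    h m with m <? t
    ... | yes _ = p m
    ... | no  _ = p r
    h-below : ∀ {m} → m < t → h m ≡ p m
    h-below {m} m<t with m <? t
    ... | yes _   = refl
    ... | no  m≮t = contradiction m<t m≮t
    h-at : h t ≡ p r
    h-at with t <? t
    ... | yes t<t = contradiction t<t (<-irrefl refl)
    ... | no  _   = refl
    h<t : ∀ m → m ≤ t → h m < t
    h<t m m≤t with m <? t
    ... | yes m<t = prefixClosed m<t
    ... | no  _   = pr<t
    g : Fin (suc t) → Fin t
    g x = fromℕ< (h<t (toℕ x) (s≤s⁻¹ (toℕ<n x)))
    toℕ-g : ∀ x → toℕ (g x) ≡ h (toℕ x)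
    toℕ-g x = toℕ-fromℕ< (h<t (toℕ x) (s≤s⁻¹ (toℕ<n x)))
    collision : ⊥
    collision with pigeonhole (n<1+n t) g
    ... | x , y , x<y , gx≡gy = distinctRows (m<1+n⇒m<n∨m≡n (toℕ<n y))
      where
      open ≡-Reasoning
      x<t = <-≤-trans x<y (s≤s⁻¹ (toℕ<n y))
      hx≡hy = trans (sym (toℕ-g x)) (trans (cong toℕ gx≡gy) (toℕ-g y))
      distinctRows : toℕ y < t ⊎ toℕ y ≡ t → ⊥
      distinctRows (inj₁ y<t) = <⇒≢ x<y (inj (<-≤-trans x<t t≤n) (<-≤-trans y<t t≤n) (begin
        p (toℕ x)  ≡⟨ h-below x<t ⟨
        h (toℕ x)  ≡⟨ hx≡hy ⟩
        h (toℕ y)  ≡⟨ h-below y<t ⟩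
        p (toℕ y)  ∎))
      distinctRows (inj₂ y≡t) = <⇒≢ (<-≤-trans x<t t≤r) (inj (<-≤-trans x<t t≤n) r<n (begin
        p (toℕ x)  ≡⟨ h-below x<t ⟨
        h (toℕ x)  ≡⟨ hx≡hy ⟩
        h (toℕ y)  ≡⟨ cong h y≡t ⟩
        h t        ≡⟨ h-at ⟩
        p r        ∎))

Start : ℕ → (ℕ → ℕ) → ℕ → Set
Start n p s = suc s < n × s < p s × p (suc s) < suc s

start? : ∀ n p → Decidable (Start n p)
start? n p s = suc s <? n ×-dec s <? p s ×-dec p (suc s) <? suc s

start-noConsecutive : ∀ {n p s} → Start n p s → ¬ Start n p (suc s)
start-noConsecutive (_ , _ , ps+1<s+1) (_ , s+1<ps+1 , _) = <-asym s+1<ps+1 ps+1<s+1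

-- Take the first negative row s + 1.  If row s is not positive it is fixed; then
-- either an earlier row maps above s, giving a 321 pattern with rows s and s + 1, or
-- all rows below s are fixed, and p (s + 1) < s collides with one of them.
moved⇒start : ∀ {n p} → InjectiveOn n p → (∀ {i} → i < n → p i < n) → Avoids321 n p →
  ∀ {x} → x < n → p x ≢ x → ∃ (Start n p)
moved⇒start {n} {p} inj range avoids {x} x<n px≢x with noneBelow-or-least (λ j → p j <? j) n
... | inj₁ noNegative = contradiction (expansive-injection⇒id inj (λ i<n → ≮⇒≥ (noNegative i<n) , range i<n) x<n) px≢x
... | inj₂ (suc s , s+1<n , negative , nonNegativeBefore) with s <? p s
...   | yes positive = s , s+1<n , positive , negative
...   | no ¬positive = ⊥-elim noFixedPoint
  where
  s<n = <-trans (n<1+n s) s+1<n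
  ps≡s : p s ≡ s
  ps≡s = ≤-antisym (≮⇒≥ ¬positive) (≮⇒≥ (nonNegativeBefore (n<1+n s)))
  ps+1<s : p (suc s) < s
  ps+1<s = ≤∧≢⇒< (s≤s⁻¹ negative) λ eq → 1+n≢n (inj s+1<n s<n (trans eq (sym ps≡s)))
  noFixedPoint : ⊥
  noFixedPoint with anyUpTo? (λ r → s <? p r) s
  ... | yes (r , r<s , s<pr) =
    avoids r<s (n<1+n s) s+1<n (subst (p (suc s) <_) (sym ps≡s) ps+1<s) (subst (_< p r) (sym ps≡s) s<pr)
  ... | no noneAbove =
    <⇒≢ (<-trans ps+1<s (n<1+n s)) (inj (<-trans ps+1<s s<n) s+1<n (identityBelow ps+1<s))
    where
    identityBelow : ∀ {r} → r < s → p r ≡ r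
    identityBelow = expansive-injection⇒id (λ i<s j<s → inj (<-trans i<s s<n) (<-trans j<s s<n)) bounds
      where
      bounds : ∀ {r} → r < s → r ≤ p r × p r < s
      bounds {r} r<s = ≮⇒≥ (nonNegativeBefore (m<n⇒m<1+n r<s)) ,
        ≤∧≢⇒< (≮⇒≥ λ s<pr → noneAbove (r , r<s , s<pr)) λ pr≡s → <⇒≢ r<s (inj (<-trans r<s s<n) s<n (trans pr≡s (sym ps≡s)))

swapStarts : ℕ → (ℕ → ℕ) → ℕ → ℕ
swapStarts n p = PairSwap.pairSwap (start? n p)

count : ∀ {ℓ} {P : Pred ℕ ℓ} → Decidable P → ℕ → ℕ
count P? zero    = 0
count P? (suc t) = (if does (P? t) then 1 else 0) + count P? t

count-pos : ∀ {ℓ} {P : Pred ℕ ℓ} (P? : Decidable P) {s t} → P s → s < t → 0 < count P? t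
count-pos P? {s} {suc t} Ps s<1+t with m<1+n⇒m<n∨m≡n s<1+t
... | inj₁ s<t  = <-≤-trans (count-pos P? Ps s<t) (m≤n+m _ _)
... | inj₂ refl rewrite dec-true (P? s) Ps = s≤s z≤n

excess : (ℕ → ℕ) → ℕ → ℕ
excess p zero    = 0
excess p (suc t) = excess p t + (p t ∸ t)

module _ {n : ℕ} {p q : ℕ → ℕ} (q≗p∘swap : ∀ {r} → r < n → q r ≡ p (swapStarts n p r)) where

  open PairSwap (start? n p)

  private
    noConsecutive : ∀ {s} → Start n p s → ¬ Start n p (suc s)
    noConsecutive = start-noConsecutive {n} {p}

    swap-first : ∀ {s} → Start n p s → q s ≡ p (suc s)
    swap-first S@(s+1<n , _) = trans (q≗p∘swap (<-trans (n<1+n _) s+1<n)) (cong p (pairSwap-first S))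

    swap-second : ∀ {s} → Start n p s → q (suc s) ≡ p s
    swap-second S@(s+1<n , _) = trans (q≗p∘swap s+1<n) (cong p (pairSwap-second (noConsecutive S) S))

    swap-fixed : ∀ {r} → r < n → ¬ Start n p r → (∀ {s} → r ≡ suc s → ¬ Start n p s) → q r ≡ p r
    swap-fixed r<n ¬Sr ¬Spred = trans (q≗p∘swap r<n) (cong p (pairSwap-fixed ¬Sr ¬Spred))

    swap-ascends : ∀ {s} → Start n p s → q s < q (suc s)
    swap-ascends S@(_ , s<ps , ps+1<s+1) =
      subst₂ _<_ (sym (swap-first S)) (sym (swap-second S)) (≤-<-trans (s≤s⁻¹ ps+1<s+1) s<ps)

  swapStarts-preserves-Avoids321 : Avoids321 n p → Avoids321 n q
  swapStarts-preserves-Avoids321 avoids {i} {j} {k} i<j j<k k<n qk<qj qj<qi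
    with start? n p i ×-dec (j ≟ suc i) | start? n p j ×-dec (k ≟ suc j)
  ... | yes (Si , refl) | _                = <-asym qj<qi (swap-ascends Si)
  ... | no _            | yes (Sj , refl)  = <-asym qk<qj (swap-ascends Sj)
  ... | no ijUnswapped  | no jkUnswapped   =
    avoids (pairSwap-monotone noConsecutive i<j ijUnswapped)
           (pairSwap-monotone noConsecutive j<k jkUnswapped)
           (pairSwap-< noConsecutive proj₁ k<n)
           (subst₂ _<_ (q≗p∘swap k<n) (q≗p∘swap j<n) qk<qj)
           (subst₂ _<_ (q≗p∘swap j<n) (q≗p∘swap (<-trans i<j j<n)) qj<qi)
    where j<n = <-trans j<k k<n

  -- A swap at s replaces (p s ∸ s) + 0 by 0 + (p s ∸ suc s), so each swap lowers the
  -- excess by one.  The bound is tracked only at prefixes [0, t) that split no swapped pair.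
  private
    Aligned : ℕ → Set
    Aligned t = ∀ {s} → t ≡ suc s → ¬ Start n p s

    ExcessBound : ℕ → Set
    ExcessBound t = excess q t + count (start? n p) t ≤ excess p t

    excessBound-fixed : ∀ {t} → t < n → ¬ Start n p t → Aligned t → ExcessBound t → ExcessBound (suc t)
    excessBound-fixed {t} t<n ¬St aligned bound
      rewrite dec-false (start? n p t) ¬St | swap-fixed t<n ¬St aligned = begin
        excess q t + (p t ∸ t) + count (start? n p) t  ≡⟨ +-rearrange (excess q t) _ _ ⟩
        excess q t + count (start? n p) t + (p t ∸ t)  ≤⟨ +-monoˡ-≤ _ bound ⟩
        excess p t + (p t ∸ t)                         ∎
      where
      open ≤-Reasoning
      +-rearrange : ∀ a b c → a + b + c ≡ a + c + b
      +-rearrange = solve-∀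

    excessBound-pair : ∀ {t} → Start n p t → ExcessBound t → ExcessBound (suc (suc t))
    excessBound-pair {t} St@(_ , t<pt , pt+1<t+1) bound
      rewrite dec-true (start? n p t) St | dec-false (start? n p (suc t)) (noConsecutive St)
            | swap-first St | swap-second St
            | m≤n⇒m∸n≡0 (s≤s⁻¹ pt+1<t+1) | m≤n⇒m∸n≡0 (<⇒≤ pt+1<t+1) = begin
        excess q t + 0 + (p t ∸ suc t) + suc (count (start? n p) t) ≡⟨ +-rearrange (excess q t) _ _ ⟩
        excess q t + count (start? n p) t + suc (p t ∸ suc t)       ≤⟨ +-mono-≤ bound (∸-monoʳ-< (n<1+n t) t<pt) ⟩
        excess p t + (p t ∸ t)                                     ≡⟨ +-identityʳ _ ⟨
        excess p t + (p t ∸ t) + 0                                 ∎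
      where
      open ≤-Reasoning
      +-rearrange : ∀ a b c → a + 0 + b + suc c ≡ a + c + suc b
      +-rearrange = solve-∀

    excessBound : ∀ t → t ≤ n → Aligned t → ExcessBound t
    excessBound zero          _   _       = ≤-refl
    excessBound (suc zero)    1≤n aligned = excessBound-fixed 1≤n (aligned refl) (λ ()) ≤-refl
    excessBound (suc (suc t)) t+2≤n aligned =
      byCases (start? n p t) (excessBound t (≤-trans (n≤1+n t) t+1≤n)) (excessBound (suc t) t+1≤n)
      where
      t+1≤n = ≤-trans (n≤1+n _) t+2≤n
      byCases : Dec (Start n p t) → (Aligned t → ExcessBound t) → (Aligned (suc t) → ExcessBound (suc t)) →
                ExcessBound (suc (suc t))
      byCases (yes St) boundAt-t _ = excessBound-pair St (boundAt-t λ { refl Sprev → noConsecutive Sprev St })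
      byCases (no ¬St) _ boundAt-t+1 = excessBound-fixed t+2≤n (aligned refl) t+1Aligned (boundAt-t+1 t+1Aligned)
        where
        t+1Aligned : Aligned (suc t)
        t+1Aligned refl = ¬St

  swapStarts-decreases-excess : ∀ {s} → Start n p s → excess q n < excess p n
  swapStarts-decreases-excess S@(s+1<n , _) =
    <-≤-trans (m<m+n (excess q n) (count-pos (start? n p) S (<-trans (n<1+n _) s+1<n)))
              (excessBound n ≤-refl λ { refl (s+1<s+1 , _) → <-irrefl refl s+1<s+1 })

-- 0 outside [0, n) is a junk value; all lemmas below only look at arguments r < n.
extendℕ : ∀ {n} → (Fin n → Fin n) → ℕ → ℕ
extendℕ {n} f r with r <? n
... | yes r<n = toℕ (f (fromℕ< r<n))
... | no  _   = 0

module _ {n} (f : Fin n → Fin n) where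

  extendℕ-fromℕ< : ∀ {r} (r<n : r < n) → extendℕ f r ≡ toℕ (f (fromℕ< r<n))
  extendℕ-fromℕ< {r} r<n with r <? n
  ... | yes _   = refl
  ... | no  r≮n  = contradiction r<n r≮n

  extendℕ-toℕ : ∀ x → extendℕ f (toℕ x) ≡ toℕ (f x)
  extendℕ-toℕ x = trans (extendℕ-fromℕ< (toℕ<n x)) (cong (toℕ ∘ f) (fromℕ<-toℕ x (toℕ<n x)))

  extendℕ-< : ∀ {r} → r < n → extendℕ f r < n
  extendℕ-< r<n = subst (_< n) (sym (extendℕ-fromℕ< r<n)) (toℕ<n _)

  extendℕ-injective : (∀ {x y} → f x ≡ f y → x ≡ y) → InjectiveOn n (extendℕ f)
  extendℕ-injective inj {i} {j} i<n j<n eq =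
    trans (sym (toℕ-fromℕ< i<n))
          (trans (cong toℕ (inj (toℕ-injective (trans (sym (extendℕ-fromℕ< i<n)) (trans eq (extendℕ-fromℕ< j<n))))))
                 (toℕ-fromℕ< j<n))

Avoids321-extendℕ : ∀ {n} (f : Fin n → Fin n) →
  (∀ {I J K} → toℕ I < toℕ J → toℕ J < toℕ K → toℕ (f K) < toℕ (f J) → toℕ (f J) < toℕ (f I) → ⊥) →
  Avoids321 n (extendℕ f)
Avoids321-extendℕ f no321 {i} {j} {k} i<j j<k k<n fk<fj fj<fi =
  no321 (subst₂ _<_ (sym (toℕ-fromℕ< i<n)) (sym (toℕ-fromℕ< j<n)) i<j)
        (subst₂ _<_ (sym (toℕ-fromℕ< j<n)) (sym (toℕ-fromℕ< k<n)) j<k)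
        (subst₂ _<_ (extendℕ-fromℕ< f k<n) (extendℕ-fromℕ< f j<n) fk<fj)
        (subst₂ _<_ (extendℕ-fromℕ< f j<n) (extendℕ-fromℕ< f i<n) fj<fi)
  where
  j<n = <-trans j<k k<n
  i<n = <-trans i<j j<n

-- Permutation matrices

δ : ℕ → ℕ → ℕ
δ a b = if a ≡ᵇ b then 1 else 0

δ-≡ : ∀ {a b} → a ≡ b → δ a b ≡ 1
δ-≡ {a} refl rewrite Equivalence.to T-≡ (≡⇒≡ᵇ a a refl) = refl

δ-≢ : ∀ {a b} → a ≢ b → δ a b ≡ 0
δ-≢ {a} {b} a≢b with a ≡ᵇ b in eq
... | true  = contradiction (≡ᵇ⇒≡ a b (Equivalence.from T-≡ eq)) a≢b
... | false = refl

δ≡1⇒≡ : ∀ a b → δ a b ≡ 1 → a ≡ b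
δ≡1⇒≡ a b e with a ≡ᵇ b in eq
... | true  = ≡ᵇ⇒≡ a b (Equivalence.from T-≡ eq)
... | false = contradiction e 0≢1+n

permMat : ∀ {n} → (Fin n → Fin n) → Mat n
permMat f i j = δ (toℕ (f i)) (toℕ j)

permMat-cong : ∀ {n} {f g : Fin n → Fin n} → (∀ x → f x ≡ g x) → permMat f ≈ permMat g
permMat-cong f≗g i j rewrite f≗g i = refl

sum-zero-weights : ∀ {n} (h g : Fin n → ℕ) → (∀ k → h k ≡ 0) → sum (tabulate (λ k → h k * g k)) ≡ 0
sum-zero-weights {zero}  h g h≡0 = refl
sum-zero-weights {suc n} h g h≡0 rewrite h≡0 fzero = sum-zero-weights (h ∘ fsuc) (g ∘ fsuc) (h≡0 ∘ fsuc)

sum-δ-weights : ∀ {n} (h g : Fin n → ℕ) x → (∀ k → h k ≡ δ (toℕ x) (toℕ k)) → sum (tabulate (λ k → h k * g k)) ≡ g x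
sum-δ-weights {suc n} h g fzero    h≡δ rewrite h≡δ fzero | sum-zero-weights (h ∘ fsuc) (g ∘ fsuc) (h≡δ ∘ fsuc) =
  trans (+-identityʳ _) (+-identityʳ _)
sum-δ-weights {suc n} h g (fsuc x) h≡δ rewrite h≡δ fzero = sum-δ-weights (h ∘ fsuc) (g ∘ fsuc) x (h≡δ ∘ fsuc)

⊗-permMatˡ : ∀ {n} {A : Mat n} (f : Fin n → Fin n) (B : Mat n) → A ≈ permMat f → ∀ i j → (A ⊗ B) i j ≡ B (f i) j
⊗-permMatˡ {A = A} f B A≈f i j = sum-δ-weights (A i) (λ k → B k j) (f i) (A≈f i)

col-permMat : ∀ {n} {Q : Mat n} {f : Fin n → Fin n} → Q ≈ permMat f → ∀ i → col Q i ≡ f i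
col-permMat {Q = Q} {f} Q≈f i with any? (λ j → Q i j ≟ 1)
... | yes (j , Qij≡1) = sym (toℕ-injective (δ≡1⇒≡ _ _ (trans (sym (Q≈f i j)) Qij≡1)))
... | no  ¬∃        = contradiction (f i , trans (Q≈f i (f i)) (δ-≡ {toℕ (f i)} refl)) ¬∃

sum-tabulate-≥ : ∀ {n} (f : Fin n → ℕ) x → f x ≤ sum (tabulate f)
sum-tabulate-≥ f fzero    = m≤m+n (f fzero) _
sum-tabulate-≥ f (fsuc x) = ≤-trans (sum-tabulate-≥ (f ∘ fsuc) x) (m≤n+m _ (f fzero))

module _ {n} {Q : Mat n} (isPerm : IsPermMatrix Q) where

  private
    zeroOne = proj₁ isPerm
    rowOne  = proj₁ (proj₂ isPerm)
    colOne  = proj₂ (proj₂ isPerm)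

  col-one : ∀ i → Q i (col Q i) ≡ 1
  col-one i with any? (λ j → Q i j ≟ 1)
  ... | yes (_ , Qij≡1) = Qij≡1
  ... | no  ¬∃ = contradiction (proj₁ (rowOne i) , proj₁ (proj₂ (rowOne i))) ¬∃

  ≈permMat-col : Q ≈ permMat (col Q)
  ≈permMat-col i j with zeroOne i j | rowOne i
  ... | inj₂ Qij≡1 | _ , _ , unique =
    trans Qij≡1 (sym (δ-≡ (cong toℕ (trans (unique _ (col-one i)) (sym (unique j Qij≡1))))))
  ... | inj₁ Qij≡0 | _ =
    trans Qij≡0 (sym (δ-≢ λ eq → 0≢1+n (trans (sym Qij≡0) (subst (λ k → Q i k ≡ 1) (toℕ-injective eq) (col-one i)))))

  col-injective : ∀ {x y} → col Q x ≡ col Q y → x ≡ y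
  col-injective {x} {y} eq with colOne (col Q x)
  ... | _ , _ , unique = trans (unique x (col-one x)) (sym (unique y (subst (λ k → Q y k ≡ 1) (sym eq) (col-one y))))

IsPermMatrix-⊗ : ∀ {n} {A Q : Mat n} (σ : Fin n → Fin n) → A ≈ permMat σ → (∀ x → σ (σ x) ≡ x) →
  IsPermMatrix Q → IsPermMatrix (A ⊗ Q)
IsPermMatrix-⊗ {A = A} {Q} σ A≈σ σσ≡id (zeroOne , rowOne , colOne) =
  (λ i j → subst (λ v → v ≡ 0 ⊎ v ≡ 1) (sym (entry i j)) (zeroOne (σ i) j)) ,
  (λ i → let (j , Qσij≡1 , unique) = rowOne (σ i)
         in j , trans (entry i j) Qσij≡1 , λ j′ e → unique j′ (trans (sym (entry i j′)) e)) ,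
  (λ j → let (i , Qij≡1 , unique) = colOne j
         in σ i , trans (entry (σ i) j) (subst (λ k → Q k j ≡ 1) (sym (σσ≡id i)) Qij≡1) ,
            λ i′ e → trans (sym (σσ≡id i′)) (cong σ (unique (σ i′) (trans (sym (entry i′ j)) e))))
  where
  entry : ∀ i j → (A ⊗ Q) i j ≡ Q (σ i) j
  entry = ⊗-permMatˡ σ Q A≈σ

-- Transposes k and k + 1; the identity when k + 1 ≥ n.
swapAdj : ∀ {n} → ℕ → Fin n → Fin n
swapAdj {suc (suc _)} zero fzero            = fsuc fzero
swapAdj {suc (suc _)} zero (fsuc fzero)     = fzero
swapAdj {suc (suc _)} zero (fsuc (fsuc i))  = fsuc (fsuc i)
swapAdj {suc zero}    zero i                = i
swapAdj               (suc k) fzero         = fzero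
swapAdj               (suc k) (fsuc i)      = fsuc (swapAdj k i)

swapMat≈permMat : ∀ {n} k → suc k < n → swapMat {n} k ≈ permMat (swapAdj k)
swapMat≈permMat {suc (suc _)} zero _ fzero           fzero           = refl
swapMat≈permMat {suc (suc _)} zero _ fzero           (fsuc fzero)    = refl
swapMat≈permMat {suc (suc _)} zero _ fzero           (fsuc (fsuc j)) = refl
swapMat≈permMat {suc (suc _)} zero _ (fsuc fzero)    fzero           = refl
swapMat≈permMat {suc (suc _)} zero _ (fsuc fzero)    (fsuc fzero)    = refl
swapMat≈permMat {suc (suc _)} zero _ (fsuc fzero)    (fsuc (fsuc j)) = refl
swapMat≈permMat {suc (suc _)} zero _ (fsuc (fsuc i)) fzero           = refl
swapMat≈permMat {suc (suc _)} zero _ (fsuc (fsuc i)) (fsuc fzero)    = refl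
swapMat≈permMat {suc (suc _)} zero _ (fsuc (fsuc i)) (fsuc (fsuc j))
  rewrite ∧-identityʳ (toℕ i ≡ᵇ toℕ j) = refl
swapMat≈permMat {suc zero}    zero (s≤s ()) _ _
swapMat≈permMat {suc _} (suc k) _ fzero    fzero    = refl
swapMat≈permMat {suc _} (suc k) _ fzero    (fsuc j) = refl
swapMat≈permMat {suc _} (suc k) _ (fsuc i) fzero
  rewrite ∧-zeroʳ (toℕ i ≡ᵇ k) | ∧-zeroʳ (toℕ i ≡ᵇ suc k) = refl
swapMat≈permMat {suc _} (suc k) k+1<n (fsuc i) (fsuc j) = swapMat≈permMat k (s<s⁻¹ k+1<n) i j

toℕ-swapAdj-left : ∀ {n} k (x : Fin n) → suc k < n → toℕ x ≡ k → toℕ (swapAdj k x) ≡ suc k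
toℕ-swapAdj-left {suc (suc _)} zero    fzero    _         _  = refl
toℕ-swapAdj-left {suc zero}    zero    fzero    (s≤s ()) _
toℕ-swapAdj-left               (suc k) (fsuc x) k+1<n     eq =
  cong suc (toℕ-swapAdj-left k x (s<s⁻¹ k+1<n) (suc-injective eq))

toℕ-swapAdj-right : ∀ {n} k (x : Fin n) → suc k < n → toℕ x ≡ suc k → toℕ (swapAdj k x) ≡ k
toℕ-swapAdj-right {suc (suc _)} zero    (fsuc fzero) _         _  = refl
toℕ-swapAdj-right {suc zero}    zero    _            (s≤s ()) _
toℕ-swapAdj-right               (suc k) (fsuc x)     k+1<n     eq =
  cong suc (toℕ-swapAdj-right k x (s<s⁻¹ k+1<n) (suc-injective eq))

swapAdj-other : ∀ {n} k (x : Fin n) → toℕ x ≢ k → toℕ x ≢ suc k → swapAdj k x ≡ x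
swapAdj-other {suc (suc _)} zero    fzero           x≢k _      = contradiction refl x≢k
swapAdj-other {suc (suc _)} zero    (fsuc fzero)    _   x≢k+1  = contradiction refl x≢k+1
swapAdj-other {suc (suc _)} zero    (fsuc (fsuc x)) _   _      = refl
swapAdj-other {suc zero}    zero    x               _   _      = refl
swapAdj-other               (suc k) fzero           _   _      = refl
swapAdj-other               (suc k) (fsuc x)        x≢k x≢k+1  =
  cong fsuc (swapAdj-other k x (x≢k ∘ cong suc) (x≢k+1 ∘ cong suc))

applySwaps : ∀ {n} → List (Fin n) → Fin n → Fin n
applySwaps []      x = x
applySwaps (a ∷ L) x = applySwaps L (swapAdj (toℕ a) x)

foldr-swapMat≈permMat : ∀ {n} (L : List (Fin n)) → All (λ a → suc (toℕ a) < n) L →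
  foldr (λ i M → swapMat (toℕ i) ⊗ M) I L ≈ permMat (applySwaps L)
foldr-swapMat≈permMat []      []               i j = refl
foldr-swapMat≈permMat (a ∷ L) (a+1<n ∷ inRange) i j =
  trans (⊗-permMatˡ (swapAdj (toℕ a)) (foldr (λ i M → swapMat (toℕ i) ⊗ M) I L) (swapMat≈permMat (toℕ a) a+1<n) i j)
        (foldr-swapMat≈permMat L inRange _ j)

NonAdjacent : ∀ {n} → List (Fin n) → Set
NonAdjacent L = ∀ {a b} → a ∈ L → b ∈ L → toℕ b ≢ suc (toℕ a)

private
  head∉tail : ∀ {n} {a : Fin n} {L} → Unique (a ∷ L) → a ∉ L
  head∉tail (a≢L ∷ _) a∈L = All.lookup a≢L a∈L refl

applySwaps-other : ∀ {n} (L : List (Fin n)) x → x ∉ L → (∀ {a} → a ∈ L → toℕ x ≢ suc (toℕ a)) →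
  applySwaps L x ≡ x
applySwaps-other []      x _   _ = refl
applySwaps-other (a ∷ L) x x∉L x≢L+1 =
  trans (cong (applySwaps L) (swapAdj-other (toℕ a) x (x∉L ∘ here ∘ toℕ-injective) (x≢L+1 (here refl))))
        (applySwaps-other L x (x∉L ∘ there) (x≢L+1 ∘ there))

applySwaps-left : ∀ {n} (L : List (Fin n)) → Unique L → All (λ a → suc (toℕ a) < n) L → NonAdjacent L →
  ∀ {x} → x ∈ L → toℕ (applySwaps L x) ≡ suc (toℕ x)
applySwaps-left (a ∷ L) uniq (a+1<n ∷ _) nonAdj (here refl) =
  trans (cong toℕ (applySwaps-other L y y∉L y≢L+1)) toℕy
  where
  y = swapAdj (toℕ a) a
  toℕy : toℕ y ≡ suc (toℕ a)
  toℕy = toℕ-swapAdj-left (toℕ a) a a+1<n refl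
  y∉L : y ∉ L
  y∉L y∈L = nonAdj (here refl) (there y∈L) toℕy
  y≢L+1 : ∀ {b} → b ∈ L → toℕ y ≢ suc (toℕ b)
  y≢L+1 b∈L eq = head∉tail uniq (subst (_∈ L) (toℕ-injective (suc-injective (trans (sym eq) toℕy))) b∈L)
applySwaps-left (a ∷ L) uniq@(_ ∷ uniqL) (_ ∷ inRange) nonAdj (there x∈L) =
  trans (cong (toℕ ∘ applySwaps L)
              (swapAdj-other (toℕ a) _ (λ eq → head∉tail uniq (subst (_∈ L) (toℕ-injective eq) x∈L))
                                       (nonAdj (here refl) (there x∈L))))
        (applySwaps-left L uniqL inRange (λ p q → nonAdj (there p) (there q)) x∈L)

applySwaps-right : ∀ {n} (L : List (Fin n)) → Unique L → All (λ a → suc (toℕ a) < n) L → NonAdjacent L →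
  ∀ {x a} → a ∈ L → toℕ x ≡ suc (toℕ a) → toℕ (applySwaps L x) ≡ toℕ a
applySwaps-right (a ∷ L) uniq (a+1<n ∷ _) nonAdj {x} (here refl) x≡a+1 =
  trans (cong toℕ (applySwaps-other L y y∉L y≢L+1)) toℕy
  where
  y = swapAdj (toℕ a) x
  toℕy : toℕ y ≡ toℕ a
  toℕy = toℕ-swapAdj-right (toℕ a) x a+1<n x≡a+1
  y∉L : y ∉ L
  y∉L y∈L = head∉tail uniq (subst (_∈ L) (toℕ-injective toℕy) y∈L)
  y≢L+1 : ∀ {b} → b ∈ L → toℕ y ≢ suc (toℕ b)
  y≢L+1 b∈L eq = nonAdj (there b∈L) (here refl) (trans (sym toℕy) eq)
applySwaps-right (a ∷ L) uniq@(_ ∷ uniqL) (_ ∷ inRange) nonAdj {x} (there a'∈L) x≡a'+1 =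
  trans (cong (toℕ ∘ applySwaps L)
              (swapAdj-other (toℕ a) x (λ eq → nonAdj (there a'∈L) (here refl) (trans (sym eq) x≡a'+1))
                (λ eq → head∉tail uniq (subst (_∈ L) (toℕ-injective (suc-injective (trans (sym x≡a'+1) eq))) a'∈L))))
        (applySwaps-right L uniqL inRange (λ p q → nonAdj (there p) (there q)) a'∈L x≡a'+1)

-- The reducing matrix

colℕ : ∀ {n} → Mat n → ℕ → ℕ
colℕ Q = extendℕ (col Q)

module _ {n} (Q : Mat n) where

  private
    T⇒≡true : ∀ {b} → T b → b ≡ true
    T⇒≡true = Equivalence.to T-≡

    ≡true⇒T : ∀ {b} → b ≡ true → T b
    ≡true⇒T = Equivalence.from T-≡

    T-∧-intro : ∀ {a b} → T a → T b → T (a ∧ b)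
    T-∧-intro Ta Tb = Equivalence.from T-∧ (Ta , Tb)

    negativeSuccessor? : (i : Fin n) → Dec (∃ λ (j : Fin n) → (toℕ j ≡ᵇ suc (toℕ i)) ∧ negative? Q j ≡ true)
    negativeSuccessor? i = any? (λ j → (toℕ j ≡ᵇ suc (toℕ i)) ∧ negative? Q j Bool.≟ true)

  reducingStart⇒Start : ∀ {i} → reducingStart? Q i ≡ true → Start n (colℕ Q) (toℕ i)
  reducingStart⇒Start {i} isStart with Equivalence.to T-∧ (≡true⇒T isStart)
  ... | positive , successorNegative with toWitness {a? = negativeSuccessor? i} successorNegative
  ...   | j , jFacts with Equivalence.to T-∧ (≡true⇒T jFacts)
  ...     | j≡i+1 , negative =
    subst (_< n) j≡i+1′ (toℕ<n j) ,
    subst (toℕ i <_) (sym (extendℕ-toℕ (col Q) i)) (<ᵇ⇒< _ _ positive) ,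
    subst₂ _<_ (trans (sym (extendℕ-toℕ (col Q) j)) (cong (colℕ Q) j≡i+1′)) j≡i+1′ (<ᵇ⇒< _ _ negative)
    where
    j≡i+1′ : toℕ j ≡ suc (toℕ i)
    j≡i+1′ = ≡ᵇ⇒≡ _ _ j≡i+1

  Start⇒reducingStart : ∀ {i} → Start n (colℕ Q) (toℕ i) → reducingStart? Q i ≡ true
  Start⇒reducingStart {i} (i+1<n , positive , successorNegative) =
    T⇒≡true (T-∧-intro (<⇒<ᵇ (subst (toℕ i <_) (extendℕ-toℕ (col Q) i) positive))
                       (fromWitness {a? = negativeSuccessor? i} (j , T⇒≡true (T-∧-intro (≡⇒≡ᵇ _ _ toℕj) (<⇒<ᵇ negative)))))
    where
    j = fromℕ< i+1<n
    toℕj : toℕ j ≡ suc (toℕ i)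
    toℕj = toℕ-fromℕ< i+1<n
    negative : toℕ (col Q j) < toℕ j
    negative = subst₂ _<_ (trans (cong (colℕ Q) (sym toℕj)) (extendℕ-toℕ (col Q) j)) (sym toℕj) successorNegative

  private
    isReducing? : ∀ i → Dec (reducingStart? Q i ≡ true)
    isReducing? i = reducingStart? Q i Bool.≟ true

  reducingRows : List (Fin n)
  reducingRows = filter isReducing? (allFin n)

  reducer : Fin n → Fin n
  reducer = applySwaps reducingRows

  private
    open PairSwap (start? n (colℕ Q)) using (first; second; fixed; pairSwapView; pairSwap-involutive)

    ∈reducingRows⇒Start : ∀ {i} → i ∈ reducingRows → Start n (colℕ Q) (toℕ i)
    ∈reducingRows⇒Start i∈ = reducingStart⇒Start (proj₂ (∈-filter⁻ isReducing? {xs = allFin n} i∈))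

    Start⇒∈reducingRows : ∀ {i} → Start n (colℕ Q) (toℕ i) → i ∈ reducingRows
    Start⇒∈reducingRows {i} S = ∈-filter⁺ isReducing? (∈-allFin i) (Start⇒reducingStart S)

    reducingRows-unique : Unique reducingRows
    reducingRows-unique = filter⁺ isReducing? (allFin⁺ n)

    reducingRows-inRange : All (λ a → suc (toℕ a) < n) reducingRows
    reducingRows-inRange = All.map (proj₁ ∘ reducingStart⇒Start) (all-filter isReducing? (allFin n))

    reducingRows-nonAdjacent : NonAdjacent reducingRows
    reducingRows-nonAdjacent a∈ b∈ b≡a+1 =
      start-noConsecutive {n} {colℕ Q} (∈reducingRows⇒Start a∈) (subst (Start n (colℕ Q)) b≡a+1 (∈reducingRows⇒Start b∈))

  reducingMatrix≈permMat-reducer : reducingMatrix Q ≈ permMat reducer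
  reducingMatrix≈permMat-reducer = foldr-swapMat≈permMat reducingRows reducingRows-inRange

  toℕ-reducer : ∀ x → toℕ (reducer x) ≡ swapStarts n (colℕ Q) (toℕ x)
  toℕ-reducer x with pairSwapView (toℕ x)
  ... | first Sx eq = trans (applySwaps-left reducingRows reducingRows-unique reducingRows-inRange
                                             reducingRows-nonAdjacent (Start⇒∈reducingRows Sx)) (sym eq)
  ... | second {s} x≡s+1 Ss eq = trans (applySwaps-right reducingRows reducingRows-unique reducingRows-inRange
                                          reducingRows-nonAdjacent (Start⇒∈reducingRows Sa) (trans x≡s+1 (cong suc (sym toℕa))))
                                        (trans toℕa (sym eq))
    where
    s<n = <-trans (n<1+n s) (subst (_< n) x≡s+1 (toℕ<n x))
    a = fromℕ< s<n
    toℕa : toℕ a ≡ s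
    toℕa = toℕ-fromℕ< s<n
    Sa : Start n (colℕ Q) (toℕ a)
    Sa = subst (Start n (colℕ Q)) (sym toℕa) Ss
  ... | fixed ¬Sx ¬Spred eq = trans (cong toℕ (applySwaps-other reducingRows x (¬Sx ∘ ∈reducingRows⇒Start)
                                       (λ a∈ x≡a+1 → ¬Spred x≡a+1 (∈reducingRows⇒Start a∈)))) (sym eq)

  reducer-involutive : ∀ x → reducer (reducer x) ≡ x
  reducer-involutive x = toℕ-injective (begin
    toℕ (reducer (reducer x))     ≡⟨ toℕ-reducer (reducer x) ⟩
    σ (toℕ (reducer x))           ≡⟨ cong σ (toℕ-reducer x) ⟩
    σ (σ (toℕ x))                 ≡⟨ pairSwap-involutive (start-noConsecutive {n} {colℕ Q}) (toℕ x) ⟩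
    toℕ x                         ∎)
    where
    open ≡-Reasoning
    σ = swapStarts n (colℕ Q)

module _ {n} {Q : Mat n} (isPerm : IsPermMatrix Q) where

  IsPermMatrix-reduction : IsPermMatrix (reducingMatrix Q ⊗ Q)
  IsPermMatrix-reduction = IsPermMatrix-⊗ (reducer Q) (reducingMatrix≈permMat-reducer Q) (reducer-involutive Q) isPerm

  colℕ-reduction : ∀ {r} → r < n → colℕ (reducingMatrix Q ⊗ Q) r ≡ colℕ Q (swapStarts n (colℕ Q) r)
  colℕ-reduction {r} r<n = begin
    colℕ (reducingMatrix Q ⊗ Q) r                ≡⟨ extendℕ-fromℕ< _ r<n ⟩
    toℕ (col (reducingMatrix Q ⊗ Q) x)           ≡⟨ cong toℕ (col-permMat {f = col Q ∘ reducer Q} reduction≈ x) ⟩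
    toℕ (col Q (reducer Q x))                    ≡⟨ extendℕ-toℕ (col Q) (reducer Q x) ⟨
    colℕ Q (toℕ (reducer Q x))                   ≡⟨ cong (colℕ Q) (toℕ-reducer Q x) ⟩
    colℕ Q (swapStarts n (colℕ Q) (toℕ x))       ≡⟨ cong (colℕ Q ∘ swapStarts n (colℕ Q)) (toℕ-fromℕ< r<n) ⟩
    colℕ Q (swapStarts n (colℕ Q) r)             ∎
    where
    open ≡-Reasoning
    x = fromℕ< r<n
    reduction≈ : (reducingMatrix Q ⊗ Q) ≈ permMat (col Q ∘ reducer Q)
    reduction≈ i j = trans (⊗-permMatˡ (reducer Q) Q (reducingMatrix≈permMat-reducer Q) i j) (≈permMat-col isPerm _ j)

Pseq-suc : ∀ {n} (P : Mat n) m → Pseq P (suc m) ≡ Pseq (Pseq P 1) m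
Pseq-suc P zero    = refl
Pseq-suc P (suc m) = cong (λ X → reducingMatrix X ⊗ X) (Pseq-suc P m)

Pseq-reaches-I : ∀ {n} (Q : Mat n) → IsPermMatrix Q → Avoids321 n (colℕ Q) → Acc _<_ (excess (colℕ Q) n) →
  ∃ λ m → Pseq Q m ≈ I
Pseq-reaches-I {n} Q isPerm avoids (acc smaller) with all? (λ x → col Q x ≟ᶠ x)
... | yes fixed = 0 , λ i j → trans (≈permMat-col isPerm i j) (permMat-cong fixed i j)
... | no  moved =
  let x , colx≢x = ¬∀⟶∃¬ n _ (λ x → col Q x ≟ᶠ x) moved
      s , Ss = moved⇒start (extendℕ-injective (col Q) (col-injective isPerm)) (extendℕ-< (col Q)) avoids
                 (toℕ<n x) (colx≢x ∘ toℕ-injective ∘ trans (sym (extendℕ-toℕ (col Q) x)))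
      m , Pm≈I = Pseq-reaches-I (reducingMatrix Q ⊗ Q) (IsPermMatrix-reduction isPerm)
                   (swapStarts-preserves-Avoids321 (colℕ-reduction isPerm) avoids)
                   (smaller (swapStarts-decreases-excess (colℕ-reduction isPerm) Ss))
  in suc m , subst (_≈ I) (sym (Pseq-suc Q m)) Pm≈I

module _ {n} (P : Mat n) where

  prodPerm : ℕ → Fin n → Fin n
  prodPerm zero    = id
  prodPerm (suc k) = reducer (Pseq P k) ∘ prodPerm k

  prodR≈permMat : ∀ k → prodR P k ≈ permMat (prodPerm k)
  prodR≈permMat zero    i j = refl
  prodR≈permMat (suc k) i j =
    trans (⊗-permMatˡ (prodPerm k) (R P k) (prodR≈permMat k) i j)
          (reducingMatrix≈permMat-reducer (Pseq P k) (prodPerm k i) j)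

  ≈prodR⊗Pseq : ∀ k → P ≈ (prodR P k ⊗ Pseq P k)
  ≈prodR⊗Pseq zero    i j = sym (⊗-permMatˡ id P (λ _ _ → refl) i j)
  ≈prodR⊗Pseq (suc k) i j = begin
    P i j                                       ≡⟨ ≈prodR⊗Pseq k i j ⟩
    (prodR P k ⊗ Pseq P k) i j                  ≡⟨ ⊗-permMatˡ π (Pseq P k) (prodR≈permMat k) i j ⟩
    Pseq P k (π i) j                            ≡⟨ cong (λ x → Pseq P k x j) (reducer-involutive (Pseq P k) (π i)) ⟨
    Pseq P k (σ (σ (π i))) j                    ≡⟨ ⊗-permMatˡ σ (Pseq P k) (reducingMatrix≈permMat-reducer (Pseq P k)) (σ (π i)) j ⟨
    Pseq P (suc k) (σ (π i)) j                  ≡⟨ ⊗-permMatˡ (prodPerm (suc k)) (Pseq P (suc k)) (prodR≈permMat (suc k)) i j ⟨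
    (prodR P (suc k) ⊗ Pseq P (suc k)) i j      ∎
    where
    open ≡-Reasoning
    π = prodPerm k
    σ = reducer (Pseq P k)

  Pseq≈I⇒≈prodR : ∀ m → Pseq P m ≈ I → P ≈ prodR P m
  Pseq≈I⇒≈prodR m Pm≈I i j = begin
    P i j                             ≡⟨ ≈prodR⊗Pseq m i j ⟩
    (prodR P m ⊗ Pseq P m) i j        ≡⟨ ⊗-permMatˡ (prodPerm m) (Pseq P m) (prodR≈permMat m) i j ⟩
    Pseq P m (prodPerm m i) j         ≡⟨ Pm≈I (prodPerm m i) j ⟩
    permMat (prodPerm m) i j          ≡⟨ prodR≈permMat m i j ⟨
    prodR P m i j                     ∎
    where open ≡-Reasoning

-- Sections

module _ {n} (Q : Mat n) where

  cut? : Decidable (Cut Q)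
  cut? t = (t ≤? n) ×-dec all? (λ i → (toℕ i <? t) →-dec (toℕ (col Q i) <? t))

  section-containing : ∀ {x} → x < n → ∃₂ λ a b → a ≤ x × x < b × Section Q a b
  section-containing {x} x<n with greatest-below cut? (z≤n , λ _ ()) x
                                | noneBelow-or-least (λ k → x <? k ×-dec cut? k) (suc n)
  ... | _ | inj₁ noCutAbove = contradiction (x<n , ≤-refl , λ i _ → toℕ<n (col Q i)) (noCutAbove (n<1+n n))
  ... | a , a≤x , cutA , noCutBetweenA | inj₂ (b , _ , (x<b , cutB) , noCutBeforeB) =
    a , b , a≤x , x<b , ≤-<-trans a≤x x<b , cutA , cutB , noCutInside
    where
    noCutInside : ∀ k → a < k → k < b → ¬ Cut Q k
    noCutInside k a<k k<b with k ≤? x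
    ... | yes k≤x = noCutBetweenA a<k k≤x
    ... | no  k≰x = λ cutK → noCutBeforeB k<b (≰⇒> k≰x , cutK)

sectionTrace-≥ : ∀ {n} (Q : Mat n) {a b} {J : Fin n} → InInterval a b J → Q J J ≤ sectionTrace Q a b
sectionTrace-≥ Q {a} {b} {J} (a≤J , J<b) = subst (_≤ sectionTrace Q a b) entryJ (sum-tabulate-≥ _ J)
  where
  entryJ : (if inInterval? a b J then Q J J else 0) ≡ Q J J
  entryJ rewrite Equivalence.to T-≡ (Equivalence.from T-∧ (≤⇒≤ᵇ a≤J , <⇒<ᵇ J<b)) = refl

module _ {n} {P : Mat n} (isPerm : IsPermMatrix P) where

  cut-closed-above : ∀ {t} → Cut P t → ∀ r → t ≤ toℕ r → t ≤ toℕ (col P r)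
  cut-closed-above {t} (t≤n , closed) r t≤r =
    subst (t ≤_) (extendℕ-toℕ (col P) r)
      (prefix-closed⇒suffix-closed (extendℕ-injective (col P) (col-injective isPerm)) t≤n closedℕ (toℕ<n r) t≤r)
    where
    closedℕ : ∀ {i} → i < t → colℕ P i < t
    closedℕ i<t = subst (_< t) (sym (extendℕ-fromℕ< (col P) i<n)) (closed (fromℕ< i<n) (subst (_< t) (sym (toℕ-fromℕ< i<n)) i<t))
      where i<n = <-≤-trans i<t t≤n

  module _ (strang : StrangCanonical P) (traceZero : NontrivialSectionsTraceZero P) where

    private
      c : Fin n → ℕ
      c x = toℕ (col P x)

    strang⇒no321 : ∀ {I J K} → toℕ I < toℕ J → toℕ J < toℕ K → c K < c J → c J < c I → ⊥
    strang⇒no321 {I} {J} {K} I<J J<K cK<cJ cJ<cI with <-cmp (toℕ J) (c J)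
    ... | tri< positiveJ _ _ with section-containing P (toℕ<n I)
    ...   | a , b , a≤I , I<b , sec@(_ , _ , (_ , closedB) , _) =
      <-asym cJ<cI (proj₁ (strang a b sec) I J (a≤I , I<b) (≤-trans a≤I (<⇒≤ I<J) , J<b) I<J positiveI positiveJ)
      where
      positiveI = <-trans I<J (<-trans positiveJ cJ<cI)
      J<b = <-trans positiveJ (<-trans cJ<cI (closedB I I<b))
    strang⇒no321 {I} {J} {K} I<J J<K cK<cJ cJ<cI | tri> _ _ negativeJ with section-containing P (toℕ<n K)
    ...   | a , b , a≤K , K<b , sec@(_ , cutA , _) =
      <-asym cK<cJ (proj₂ (strang a b sec) J K (a≤J , <-trans J<K K<b) (a≤K , K<b) J<K negativeJ negativeK)
      where
      negativeK = <-trans cK<cJ (<-trans negativeJ J<K)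
      a≤J = <⇒≤ (≤-<-trans (cut-closed-above cutA K a≤K) (<-trans cK<cJ negativeJ))
    strang⇒no321 {I} {J} {K} I<J J<K cK<cJ cJ<cI | tri≈ _ fixedJ _ with section-containing P (toℕ<n J)
    ...   | a , b , a≤J , J<b , sec@(_ , (_ , closedA) , _) =
      contradiction (subst (1 ≤_) (traceZero a b sec (≤-<-trans a<J J<b)) one≤trace) λ ()
      where
      a<J : a < toℕ J
      a<J = ≤∧≢⇒< a≤J λ a≡J → <-asym cJ<cI (subst (c I <_) (trans a≡J fixedJ) (closedA I (subst (toℕ I <_) (sym a≡J) I<J)))
      PJJ≡1 : P J J ≡ 1
      PJJ≡1 = subst (λ k → P J k ≡ 1) (toℕ-injective (sym fixedJ)) (col-one isPerm J)
      one≤trace : 1 ≤ sectionTrace P a b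
      one≤trace = subst (_≤ sectionTrace P a b) PJJ≡1 (sectionTrace-≥ P (a≤J , J<b))

    strang⇒Avoids321 : Avoids321 n (colℕ P)
    strang⇒Avoids321 = Avoids321-extendℕ (col P) strang⇒no321

lemma2p11 : (n : ℕ) (P : Mat n) → IsPermMatrix P → StrangCanonical P →
    NontrivialSectionsTraceZero P →
    Σ ℕ λ m → (Pseq P m ≈ I) × (P ≈ prodR P m)
lemma2p11 n P isPerm strang traceZero =
  let m , Pm≈I = Pseq-reaches-I P isPerm (strang⇒Avoids321 isPerm strang traceZero) (<-wellFounded _)
  in  m , Pm≈I , Pseq≈I⇒≈prodR P m Pm≈I
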